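{- Let $\Gamma(2)$ and $\Gamma(8)$ be the principal congruence subgroups of level $2$ and $8$ of $\mathrm{SL}_{2}(\mathbb{Z})$. Then $\Gamma(2)$ is the direct product of the scalar subgroup $\{\pm 1\}$ with a subgroup $\Gamma(2)'$ (containing $\Gamma(8)$), and the quotient $\Gamma(2)'/\Gamma(8)$ has the presentation $$\langle \sigma, \tau \mid \sigma^{4} = \tau^{4} = [\sigma^{2},\tau] = [\sigma,\tau^{2}] = [\sigma,\tau]^{2} = [[\sigma,\tau],\sigma] = [[\sigma,\tau],\tau] = 1 \rangle.$$
   Context: For $N \geq 1$, $\Gamma(N) = \{g \in \mathrm{SL}_{2}(\mathbb{Z}) : g \equiv I \bmod N\}$. $[x,y]$ denotes the commutator of $x$ and $y$. -}

module Defs where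

open import Level using (0ℓ)
open import Data.Nat using (ℕ; zero; suc)
open import Data.Integer using (ℤ; +_; 0ℤ; 1ℤ; -1ℤ; _+_; _-_; _*_; -_)
open import Data.Integer.Divisibility using (_∣_)
open import Data.Product using (Σ; _×_; _,_)
open import Data.Sum using (_⊎_)
open import Data.List using (List; []; _∷_)
open import Data.List.Relation.Unary.All using (All)
open import Relation.Nullary using (¬_)
open import Relation.Binary.PropositionalEquality using (_≡_)
open import Algebra.Bundles using (Group)

record M2 : Set where
  constructor mat
  field
    a b c d : ℤ
open M2 public

infixl 7 _⊗_
_⊗_ : M2 → M2 → M2
mat a b c d ⊗ mat a' b' c' d' =
  mat (a * a' + b * c') (a * b' + b * d') (c * a' + d * c') (c * b' + d * d')

-- adjugate; this is the inverse for matrices of determinant 1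
adj : M2 → M2
adj (mat a b c d) = mat d (- b) (- c) a

I : M2
I = mat 1ℤ 0ℤ 0ℤ 1ℤ

-I : M2
-I = mat -1ℤ 0ℤ 0ℤ -1ℤ

det : M2 → ℤ
det (mat a b c d) = a * d - b * c

SL2 : M2 → Set
SL2 m = det m ≡ 1ℤ

Γ : ℕ → M2 → Set
Γ N (mat a b c d) =
  SL2 (mat a b c d) × ((+ N) ∣ (a - 1ℤ)) × ((+ N) ∣ b) × ((+ N) ∣ c) × ((+ N) ∣ (d - 1ℤ))

record Subgroup : Set₁ where
  field
    P     : M2 → Set
    P⇒SL2 : ∀ {m} → P m → SL2 m
    P-I   : P I
    P-⊗   : ∀ {g h} → P g → P h → P (g ⊗ h)
    P-inv : ∀ {g} → P g → P (adj g)

infixl 7 _·_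
data Word : Set where
  σ τ e : Word
  _·_   : Word → Word → Word
  _⁻    : Word → Word

_^_ : Word → ℕ → Word
w ^ zero  = e
w ^ suc n = w · (w ^ n)

-- commutator convention [x,y] = x⁻¹ y⁻¹ x y
[_,_] : Word → Word → Word
[ x , y ] = (x ⁻) · (y ⁻) · x · y

relators : List Word
relators =
  (σ ^ 4) ∷ (τ ^ 4) ∷ [ σ ^ 2 , τ ] ∷ [ σ , τ ^ 2 ] ∷ ([ σ , τ ] ^ 2)
  ∷ [ [ σ , τ ] , σ ] ∷ [ [ σ , τ ] , τ ] ∷ []

evalM : Word → M2 → M2 → M2
evalM σ s t = s
evalM τ s t = t
evalM e s t = I
evalM (w · v) s t = evalM w s t ⊗ evalM v s t
evalM (w ⁻) s t = adj (evalM w s t)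

evalG : (G : Group 0ℓ 0ℓ) → Group.Carrier G → Group.Carrier G → Word → Group.Carrier G
evalG G x y σ = x
evalG G x y τ = y
evalG G x y e = Group.ε G
evalG G x y (w · v) = Group._∙_ G (evalG G x y w) (evalG G x y v)
evalG G x y (w ⁻) = Group._⁻¹ G (evalG G x y w)

-- H / Γ(8) (for Γ(8) ⊆ H) has presentation ⟨σ,τ | relators⟩:
-- elements s,t ∈ H whose classes satisfy the relators and generate H/Γ(8),
-- and which satisfy the universal property of the presented group.

module _ (H : Subgroup) where
  open Subgroup H

  _~_ : M2 → M2 → Set
  g ~ h = Γ 8 (adj g ⊗ h)

  HasPresentationModΓ8 : Set₁
  HasPresentationModΓ8 =
    Σ M2 λ s → Σ M2 λ t → Σ (P s) λ ps → Σ (P t) λ pt →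
      All (λ r → evalM r s t ~ I) relators ×
      (∀ m → P m → Σ Word λ w → evalM w s t ~ m) ×
      ((G : Group 0ℓ 0ℓ) (x y : Group.Carrier G) →
        All (λ r → Group._≈_ G (evalG G x y r) (Group.ε G)) relators →
        Σ ((m : M2) → P m → Group.Carrier G) λ f →
          (∀ g h (pg : P g) (ph : P h) → g ~ h → Group._≈_ G (f g pg) (f h ph)) ×
          (∀ g h (pg : P g) (ph : P h) →
            Group._≈_ G (f (g ⊗ h) (P-⊗ pg ph)) (Group._∙_ G (f g pg) (f h ph))) ×
          Group._≈_ G (f s ps) x ×
          Group._≈_ G (f t pt) y)

-- Γ(2) is the internal direct product {±1} × H
IsComplementOfSign : Subgroup → Set
IsComplementOfSign H =
  (∀ {m} → P m → Γ 2 m) × ¬ P -I × (∀ m → Γ 2 m → P m ⊎ P (-I ⊗ m))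
  where open Subgroup H

{-# OPTIONS --safe #-}
module Submission where

-- Every matrix of Γ(2) has ad ≡ 1 (mod 4) with a, d odd, so its diagonal entries are both ≡ 1
-- or both ≡ -1 (mod 4); hence Γ(2) = {±1} × Γ(2)′, with Γ(2)′ the subgroup whose diagonal is
-- ≡ 1 (mod 4). Reduction mod 8 embeds Γ(2)′/Γ(8) in SL₂(ℤ/8), and a finite computation shows
-- that the image consists of the 32 distinct residues of σⁱ τʲ [σ,τ]ᵏ (i, j < 4, k < 2), where
-- σ = (1 2; 0 1) and τ = (1 0; 2 1), multiplied by (i, j, k)(i′, j′, k′) = (i + i′, j + j′, k + k′ + i′j).
-- In any group, elements x, y satisfying the relators have [x,y] central of order 2 and
-- y x = x y [x,y], so yʲ xⁱ = xⁱ yʲ [x,y]^(ij) and the products xⁱ yʲ [x,y]ᵏ multiply by the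
-- same rule: sending σⁱ τʲ [σ,τ]ᵏ to xⁱ yʲ [x,y]ᵏ is the homomorphism of the universal property.

open import Level using (0ℓ)
open import Function using (_∘_)
open import Data.Nat as ℕ using (ℕ; zero; suc; NonZero; _%_; _/_)
import Data.Nat.Properties as ℕ
import Data.Nat.Divisibility as ℕ
import Data.Nat.DivMod as ℕ
open import Data.Integer as ℤ using (ℤ; +_; 0ℤ; 1ℤ; -1ℤ; _+_; _-_; _*_; -_; _%ℕ_; _/ℕ_; ∣_∣; _⊖_)
import Data.Integer.Properties as ℤ
open import Data.Integer.DivMod using (n%ℕd<d; a≡a%ℕn+[a/ℕn]*n)
open import Data.Integer.Divisibility.Signed
  using (_∣_; divides; ∣ᵤ⇒∣; ∣⇒∣ᵤ; ∣-trans; ∣m⇒∣-m; ∣m∣n⇒∣m+n; ∣m⇒∣m*n; ∣n⇒∣m*n)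
open import Data.Integer.Tactic.RingSolver using (solve-∀)
open import Data.Fin as Fin using (Fin; toℕ; fromℕ<)
open import Data.Fin.Patterns using (0F; 1F; 2F; 3F)
open import Data.Fin.Properties using (toℕ-fromℕ<; toℕ-injective; toℕ<n; all?; any?)
open import Data.Product using (Σ; _×_; _,_; ∃; proj₁; proj₂)
open import Data.Sum using (_⊎_; inj₁; inj₂)
open import Data.Empty using (⊥-elim)
open import Data.List.Relation.Unary.All as All using (All; []; _∷_)
open import Relation.Binary.PropositionalEquality using (_≡_; refl; sym; trans; cong; cong₂; subst; module ≡-Reasoning)
open import Relation.Binary.Bundles using (Setoid)
import Relation.Binary.Reasoning.Setoid as SetoidReasoning
open import Relation.Nullary using (¬_; Dec; contradiction)
open import Relation.Nullary.Decidable using (map′; toWitness; toWitnessFalse; _×-dec_; _→-dec_)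
open import Algebra.Bundles using (Group)
import Algebra.Properties.Group as GroupProperties
import Algebra.Properties.Monoid.Mult as MonoidMult
open import Tactic.MonoidSolver using (solve)
open import Defs

infix 4 _≡_mod_
record _≡_mod_ (x y : ℤ) (n : ℕ) : Set where
  constructor mod-witness
  field n∣x-y : + n ∣ x - y

module _ {n : ℕ} where

  ≡-mod-reflexive : ∀ {x y} → x ≡ y → x ≡ y mod n
  ≡-mod-reflexive {x} refl = mod-witness (divides 0ℤ (trans (ℤ.+-inverseʳ x) (sym (ℤ.*-zeroˡ (+ n)))))

  ≡-mod-refl : ∀ {x} → x ≡ x mod n
  ≡-mod-refl = ≡-mod-reflexive refl

  ≡-mod-sym : ∀ {x y} → x ≡ y mod n → y ≡ x mod n
  ≡-mod-sym {x} {y} (mod-witness x≡y) = mod-witness (subst (+ n ∣_) (swap x y) (∣m⇒∣-m x≡y))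
    where
    swap : ∀ x y → - (x - y) ≡ y - x
    swap = solve-∀

  ≡-mod-trans : ∀ {x y z} → x ≡ y mod n → y ≡ z mod n → x ≡ z mod n
  ≡-mod-trans {x} {y} {z} (mod-witness x≡y) (mod-witness y≡z) =
    mod-witness (subst (+ n ∣_) (telescope x y z) (∣m∣n⇒∣m+n x≡y y≡z))
    where
    telescope : ∀ x y z → (x - y) + (y - z) ≡ x - z
    telescope = solve-∀

  +-cong-mod : ∀ {x y x′ y′} → x ≡ y mod n → x′ ≡ y′ mod n → x + x′ ≡ y + y′ mod n
  +-cong-mod {x} {y} {x′} {y′} (mod-witness x≡y) (mod-witness x′≡y′) =
    mod-witness (subst (+ n ∣_) (split x y x′ y′) (∣m∣n⇒∣m+n x≡y x′≡y′))
    where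
    split : ∀ x y x′ y′ → (x - y) + (x′ - y′) ≡ (x + x′) - (y + y′)
    split = solve-∀

  *-cong-mod : ∀ {x y x′ y′} → x ≡ y mod n → x′ ≡ y′ mod n → x * x′ ≡ y * y′ mod n
  *-cong-mod {x} {y} {x′} {y′} (mod-witness x≡y) (mod-witness x′≡y′) =
    mod-witness (subst (+ n ∣_) (split x y x′ y′) (∣m∣n⇒∣m+n (∣m⇒∣m*n x′ x≡y) (∣n⇒∣m*n y x′≡y′)))
    where
    split : ∀ x y x′ y′ → (x - y) * x′ + y * (x′ - y′) ≡ x * x′ - y * y′
    split = solve-∀

  *-congˡ-mod : ∀ z {x y} → x ≡ y mod n → z * x ≡ z * y mod n
  *-congˡ-mod z = *-cong-mod (≡-mod-refl {z})

  *-congʳ-mod : ∀ z {x y} → x ≡ y mod n → x * z ≡ y * z mod n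
  *-congʳ-mod z x≡y = *-cong-mod x≡y (≡-mod-refl {z})

  -‿cong-mod : ∀ {x y} → x ≡ y mod n → - x ≡ - y mod n
  -‿cong-mod {x} {y} (mod-witness x≡y) = mod-witness (subst (+ n ∣_) (negate x y) (∣m⇒∣-m x≡y))
    where
    negate : ∀ x y → - (x - y) ≡ - x - - y
    negate = solve-∀

≡-mod-setoid : ℕ → Setoid 0ℓ 0ℓ
≡-mod-setoid n = record
  { Carrier = ℤ
  ; _≈_ = _≡_mod n
  ; isEquivalence = record { refl = ≡-mod-refl ; sym = ≡-mod-sym ; trans = ≡-mod-trans }
  }

module ≡-mod-Reasoning (n : ℕ) = SetoidReasoning (≡-mod-setoid n)

≡-mod-weaken : ∀ {m n x y} → m ℕ.∣ n → x ≡ y mod n → x ≡ y mod m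
≡-mod-weaken m∣n (mod-witness n∣x-y) = mod-witness (∣-trans (∣ᵤ⇒∣ m∣n) n∣x-y)

_≡?_mod_ : ∀ x y n → Dec (x ≡ y mod n)
x ≡? y mod n = map′ (mod-witness ∘ ∣ᵤ⇒∣) (∣⇒∣ᵤ ∘ _≡_mod_.n∣x-y) (n ℕ.∣? ∣ x - y ∣)

_modℤ_ : ℤ → (n : ℕ) .{{_ : NonZero n}} → Fin n
x modℤ n = fromℕ< (n%ℕd<d x n)

module _ {n : ℕ} .{{_ : NonZero n}} where

  ≡-mod-modℤ : ∀ x → x ≡ + toℕ (x modℤ n) mod n
  ≡-mod-modℤ x = mod-witness (divides (x /ℕ n) (begin
    x - + toℕ (x modℤ n)                        ≡⟨ cong (λ r → x - + r) (toℕ-fromℕ< (n%ℕd<d x n)) ⟩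
    x - + (x %ℕ n)                              ≡⟨ cong (_- + (x %ℕ n)) (a≡a%ℕn+[a/ℕn]*n x n) ⟩
    + (x %ℕ n) + (x /ℕ n) * + n - + (x %ℕ n)    ≡⟨ cancel (+ (x %ℕ n)) ((x /ℕ n) * + n) ⟩
    (x /ℕ n) * + n                              ∎))
    where
    open ≡-Reasoning
    cancel : ∀ r q → r + q - r ≡ q
    cancel = solve-∀

  residues-unique : ∀ {r r′} → r ℕ.< n → r′ ℕ.< n → + r ≡ + r′ mod n → r ≡ r′
  residues-unique {r} {r′} r<n r′<n (mod-witness r≡r′) = ℤ.+-injective (ℤ.i-j≡0⇒i≡j (+ r) (+ r′)
    (trans (ℤ.m-n≡m⊖n r r′) (ℤ.∣i∣≡0⇒i≡0 (small-multiple-is-0 n∣d d<n))))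
    where
    n∣d : n ℕ.∣ ∣ r ⊖ r′ ∣
    n∣d = subst (λ z → n ℕ.∣ ∣ z ∣) (ℤ.m-n≡m⊖n r r′) (∣⇒∣ᵤ r≡r′)
    d<n : ∣ r ⊖ r′ ∣ ℕ.< n
    d<n = ℕ.≤-<-trans (ℤ.∣m⊝n∣≤m⊔n r r′) (ℕ.⊔-lub r<n r′<n)
    small-multiple-is-0 : ∀ {d} → n ℕ.∣ d → d ℕ.< n → d ≡ 0
    small-multiple-is-0 {zero}  _   _   = refl
    small-multiple-is-0 {suc d} n∣d d<n = contradiction n∣d (ℕ.>⇒∤ d<n)

  modℤ-cong : ∀ {x y} → x ≡ y mod n → x modℤ n ≡ y modℤ n
  modℤ-cong {x} {y} x≡y = toℕ-injective (residues-unique (toℕ<n _) (toℕ<n _)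
    (≡-mod-trans (≡-mod-sym (≡-mod-modℤ x)) (≡-mod-trans x≡y (≡-mod-modℤ y))))

∣⇒≡0-mod : ∀ {n x} → + n ∣ x → x ≡ 0ℤ mod n
∣⇒≡0-mod {n} {x} n∣x = mod-witness (subst (+ n ∣_) (sym (ℤ.+-identityʳ x)) n∣x)

≡0-mod⇒∣ : ∀ {n x} → x ≡ 0ℤ mod n → + n ∣ x
≡0-mod⇒∣ {n} {x} (mod-witness n∣x-0) = subst (+ n ∣_) (ℤ.+-identityʳ x) n∣x-0

mat-cong : ∀ {a b c d a′ b′ c′ d′} → a ≡ a′ → b ≡ b′ → c ≡ c′ → d ≡ d′ → mat a b c d ≡ mat a′ b′ c′ d′
mat-cong refl refl refl refl = refl

det-⊗ : ∀ g h → det (g ⊗ h) ≡ det g * det h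
det-⊗ (mat a b c d) (mat a′ b′ c′ d′) = expand a b c d a′ b′ c′ d′
  where
  expand : ∀ a b c d a′ b′ c′ d′ →
    (a * a′ + b * c′) * (c * b′ + d * d′) - (a * b′ + b * d′) * (c * a′ + d * c′) ≡ (a * d - b * c) * (a′ * d′ - b′ * c′)
  expand = solve-∀

det-adj : ∀ g → det (adj g) ≡ det g
det-adj (mat a b c d) = expand a b c d
  where
  expand : ∀ a b c d → d * a - (- b) * (- c) ≡ a * d - b * c
  expand = solve-∀

SL2-⊗ : ∀ {g h} → SL2 g → SL2 h → SL2 (g ⊗ h)
SL2-⊗ {g} {h} g∈SL2 h∈SL2 = trans (det-⊗ g h) (cong₂ _*_ g∈SL2 h∈SL2)

SL2-adj : ∀ {g} → SL2 g → SL2 (adj g)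
SL2-adj {g} g∈SL2 = trans (det-adj g) g∈SL2

⊗-assoc : ∀ g h k → (g ⊗ h) ⊗ k ≡ g ⊗ (h ⊗ k)
⊗-assoc (mat a b c d) (mat a′ b′ c′ d′) (mat a″ b″ c″ d″) =
  mat-cong (entry a b a′ b′ c′ d′ a″ c″) (entry a b a′ b′ c′ d′ b″ d″)
           (entry c d a′ b′ c′ d′ a″ c″) (entry c d a′ b′ c′ d′ b″ d″)
  where
  entry : ∀ x y a′ b′ c′ d′ z w →
    (x * a′ + y * c′) * z + (x * b′ + y * d′) * w ≡ x * (a′ * z + b′ * w) + y * (c′ * z + d′ * w)
  entry = solve-∀

⊗-identityʳ : ∀ g → g ⊗ I ≡ g
⊗-identityʳ (mat a b c d) = mat-cong (first a b) (second a b) (first c d) (second c d)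
  where
  first : ∀ x y → x * 1ℤ + y * 0ℤ ≡ x
  first = solve-∀
  second : ∀ x y → x * 0ℤ + y * 1ℤ ≡ y
  second = solve-∀

⊗-identityˡ : ∀ g → I ⊗ g ≡ g
⊗-identityˡ (mat a b c d) = mat-cong (first a c) (first b d) (second a c) (second b d)
  where
  first : ∀ x y → 1ℤ * x + 0ℤ * y ≡ x
  first = solve-∀
  second : ∀ x y → 0ℤ * x + 1ℤ * y ≡ y
  second = solve-∀

adj-inverseʳ : ∀ {g} → SL2 g → g ⊗ adj g ≡ I
adj-inverseʳ {mat a b c d} g∈SL2 =
  mat-cong (trans (diagonal a b c d) g∈SL2) (cancel a b) (cancel′ c d) (trans (diagonal′ a b c d) g∈SL2)
  where
  diagonal : ∀ a b c d → a * d + b * (- c) ≡ a * d - b * c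
  diagonal = solve-∀
  diagonal′ : ∀ a b c d → c * (- b) + d * a ≡ a * d - b * c
  diagonal′ = solve-∀
  cancel : ∀ x y → x * (- y) + y * x ≡ 0ℤ
  cancel = solve-∀
  cancel′ : ∀ x y → x * y + y * (- x) ≡ 0ℤ
  cancel′ = solve-∀

adj-inverseˡ : ∀ {g} → SL2 g → adj g ⊗ g ≡ I
adj-inverseˡ {mat a b c d} g∈SL2 =
  mat-cong (trans (diagonal a b c d) g∈SL2) (cancel b d) (cancel′ a c) (trans (diagonal′ a b c d) g∈SL2)
  where
  diagonal : ∀ a b c d → d * a + (- b) * c ≡ a * d - b * c
  diagonal = solve-∀
  diagonal′ : ∀ a b c d → (- c) * b + a * d ≡ a * d - b * c
  diagonal′ = solve-∀
  cancel : ∀ x y → y * x + (- x) * y ≡ 0ℤ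
  cancel = solve-∀
  cancel′ : ∀ x y → (- y) * x + x * y ≡ 0ℤ
  cancel′ = solve-∀

-I⊗-negates : ∀ a b c d → -I ⊗ mat a b c d ≡ mat (- a) (- b) (- c) (- d)
-I⊗-negates a b c d = mat-cong (first a c) (first b d) (second a c) (second b d)
  where
  first : ∀ x y → -1ℤ * x + 0ℤ * y ≡ - x
  first = solve-∀
  second : ∀ x y → 0ℤ * x + -1ℤ * y ≡ - y
  second = solve-∀

infix 4 _≋_mod_
record _≋_mod_ (g h : M2) (n : ℕ) : Set where
  constructor entrywise
  field
    a≡ : a g ≡ a h mod n
    b≡ : b g ≡ b h mod n
    c≡ : c g ≡ c h mod n
    d≡ : d g ≡ d h mod n

module _ {n : ℕ} where

  ≋-reflexive : ∀ {g h} → g ≡ h → g ≋ h mod n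
  ≋-reflexive refl = entrywise ≡-mod-refl ≡-mod-refl ≡-mod-refl ≡-mod-refl

  ≋-refl : ∀ {g} → g ≋ g mod n
  ≋-refl = ≋-reflexive refl

  ≋-sym : ∀ {g h} → g ≋ h mod n → h ≋ g mod n
  ≋-sym (entrywise p q r s) = entrywise (≡-mod-sym p) (≡-mod-sym q) (≡-mod-sym r) (≡-mod-sym s)

  ≋-trans : ∀ {g h k} → g ≋ h mod n → h ≋ k mod n → g ≋ k mod n
  ≋-trans (entrywise p q r s) (entrywise p′ q′ r′ s′) =
    entrywise (≡-mod-trans p p′) (≡-mod-trans q q′) (≡-mod-trans r r′) (≡-mod-trans s s′)

  ⊗-cong-mod : ∀ {g h g′ h′} → g ≋ h mod n → g′ ≋ h′ mod n → g ⊗ g′ ≋ h ⊗ h′ mod n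
  ⊗-cong-mod (entrywise a b c d) (entrywise a′ b′ c′ d′) = entrywise
    (+-cong-mod (*-cong-mod a a′) (*-cong-mod b c′)) (+-cong-mod (*-cong-mod a b′) (*-cong-mod b d′))
    (+-cong-mod (*-cong-mod c a′) (*-cong-mod d c′)) (+-cong-mod (*-cong-mod c b′) (*-cong-mod d d′))

  det-cong-mod : ∀ {g h} → g ≋ h mod n → det g ≡ det h mod n
  det-cong-mod (entrywise a b c d) = +-cong-mod (*-cong-mod a d) (-‿cong-mod (*-cong-mod b c))

≋-setoid : ℕ → Setoid 0ℓ 0ℓ
≋-setoid n = record
  { Carrier = M2
  ; _≈_ = _≋_mod n
  ; isEquivalence = record { refl = ≋-refl ; sym = ≋-sym ; trans = ≋-trans }
  }

module ≋-Reasoning (n : ℕ) = SetoidReasoning (≋-setoid n)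

Γ⇒≋I : ∀ {n} m → Γ n m → m ≋ I mod n
Γ⇒≋I (mat _ _ _ _) (_ , a , b , c , d) =
  entrywise (mod-witness (∣ᵤ⇒∣ a)) (∣⇒≡0-mod (∣ᵤ⇒∣ b)) (∣⇒≡0-mod (∣ᵤ⇒∣ c)) (mod-witness (∣ᵤ⇒∣ d))

≋I⇒Γ : ∀ {n m} → SL2 m → m ≋ I mod n → Γ n m
≋I⇒Γ {m = mat _ _ _ _} m∈SL2 (entrywise (mod-witness a) b c (mod-witness d)) =
  m∈SL2 , ∣⇒∣ᵤ a , ∣⇒∣ᵤ (≡0-mod⇒∣ b) , ∣⇒∣ᵤ (≡0-mod⇒∣ c) , ∣⇒∣ᵤ d

matFin : ∀ {n} → Fin n → Fin n → Fin n → Fin n → M2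
matFin a b c d = mat (+ toℕ a) (+ toℕ b) (+ toℕ c) (+ toℕ d)

residue : (n : ℕ) .{{_ : NonZero n}} → M2 → M2
residue n (mat a b c d) = matFin (a modℤ n) (b modℤ n) (c modℤ n) (d modℤ n)

module _ {n : ℕ} .{{_ : NonZero n}} where

  ≋-residue : ∀ g → g ≋ residue n g mod n
  ≋-residue (mat a b c d) = entrywise (≡-mod-modℤ a) (≡-mod-modℤ b) (≡-mod-modℤ c) (≡-mod-modℤ d)

  residue-cong : ∀ {g h} → g ≋ h mod n → residue n g ≡ residue n h
  residue-cong (entrywise a b c d) = mat-cong (same a) (same b) (same c) (same d)
    where
    same : ∀ {x y} → x ≡ y mod n → + toℕ (x modℤ n) ≡ + toℕ (y modℤ n)
    same = cong (+_ ∘ toℕ) ∘ modℤ-cong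

  residue-injective : ∀ {g h} → residue n g ≡ residue n h → g ≋ h mod n
  residue-injective {g} {h} eq = ≋-trans (≋-residue g) (≋-trans (≋-reflexive eq) (≋-sym (≋-residue h)))

  residue-⊗ : ∀ g h → residue n (g ⊗ h) ≡ residue n (residue n g ⊗ residue n h)
  residue-⊗ g h = residue-cong (⊗-cong-mod (≋-residue g) (≋-residue h))

*-pres-∣ : ∀ {k l x y} → k ∣ x → l ∣ y → k * l ∣ x * y
*-pres-∣ {k} {l} (divides p refl) (divides q refl) = divides (p * q) (regroup p k q l)
  where
  regroup : ∀ p k q l → (p * k) * (q * l) ≡ (p * q) * (k * l)
  regroup = solve-∀

odd⇒≡±1-mod4 : ∀ {x} → x ≡ 1ℤ mod 2 → x ≡ 1ℤ mod 4 ⊎ x ≡ -1ℤ mod 4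
odd⇒≡±1-mod4 {x} x-odd = by-residue (x modℤ 4) (≡-mod-modℤ x)
  where
  parity : ∀ {r} → x ≡ r mod 4 → r ≡ 1ℤ mod 2
  parity x≡r = ≡-mod-trans (≡-mod-sym (≡-mod-weaken (ℕ.divides 2 refl) x≡r)) x-odd
  by-residue : ∀ (r : Fin 4) → x ≡ + toℕ r mod 4 → x ≡ 1ℤ mod 4 ⊎ x ≡ -1ℤ mod 4
  by-residue 0F x≡0 = ⊥-elim (toWitnessFalse {a? = 0ℤ ≡? 1ℤ mod 2} _ (parity x≡0))
  by-residue 1F x≡1 = inj₁ x≡1
  by-residue 2F x≡2 = ⊥-elim (toWitnessFalse {a? = (+ 2) ≡? 1ℤ mod 2} _ (parity x≡2))
  by-residue 3F x≡3 = inj₂ (≡-mod-trans x≡3 (mod-witness (divides 1ℤ refl)))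

inverse-of-self-inverse-mod : ∀ {n a d ε} → ε * ε ≡ 1ℤ → a * d ≡ 1ℤ mod n → a ≡ ε mod n → d ≡ ε mod n
inverse-of-self-inverse-mod {n} {a} {d} {ε} ε²≡1 ad≡1 a≡ε = begin
  d             ≡⟨ ℤ.*-identityˡ d ⟨
  1ℤ * d        ≡⟨ cong (_* d) ε²≡1 ⟨
  (ε * ε) * d   ≡⟨ ℤ.*-assoc ε ε d ⟩
  ε * (ε * d)   ≈⟨ *-congˡ-mod ε (*-congʳ-mod d (≡-mod-sym a≡ε)) ⟩
  ε * (a * d)   ≈⟨ *-congˡ-mod ε ad≡1 ⟩
  ε * 1ℤ        ≡⟨ ℤ.*-identityʳ ε ⟩
  ε             ∎
  where open ≡-mod-Reasoning n

record InΓ₂′ (m : M2) : Set where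
  field
    unimodular : SL2 m
    a≡1 : a m ≡ 1ℤ mod 4
    2∣b : + 2 ∣ b m
    2∣c : + 2 ∣ c m
    d≡1 : d m ≡ 1ℤ mod 4

4∣8 : 4 ℕ.∣ 8
4∣8 = ℕ.divides 2 refl

2∣8 : 2 ℕ.∣ 8
2∣8 = ℕ.divides 4 refl

InΓ₂′-I : InΓ₂′ I
InΓ₂′-I = record
  { unimodular = refl ; a≡1 = ≡-mod-refl ; 2∣b = divides 0ℤ refl ; 2∣c = divides 0ℤ refl ; d≡1 = ≡-mod-refl }

InΓ₂′-⊗ : ∀ {g h} → InΓ₂′ g → InΓ₂′ h → InΓ₂′ (g ⊗ h)
InΓ₂′-⊗ {mat a b c d} {mat a′ b′ c′ d′} g∈ h∈ = record
  { unimodular = SL2-⊗ {mat a b c d} G.unimodular H.unimodular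
  ; a≡1 = +-cong-mod (*-cong-mod G.a≡1 H.a≡1) (∣⇒≡0-mod (*-pres-∣ G.2∣b H.2∣c))
  ; 2∣b = ∣m∣n⇒∣m+n (∣n⇒∣m*n a H.2∣b) (∣m⇒∣m*n d′ G.2∣b)
  ; 2∣c = ∣m∣n⇒∣m+n (∣m⇒∣m*n a′ G.2∣c) (∣n⇒∣m*n d H.2∣c)
  ; d≡1 = +-cong-mod (∣⇒≡0-mod (*-pres-∣ G.2∣c H.2∣b)) (*-cong-mod G.d≡1 H.d≡1)
  }
  where
  module G = InΓ₂′ g∈
  module H = InΓ₂′ h∈

InΓ₂′-adj : ∀ {g} → InΓ₂′ g → InΓ₂′ (adj g)
InΓ₂′-adj {mat a b c d} g∈ = record
  { unimodular = SL2-adj {mat a b c d} unimodular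
  ; a≡1 = d≡1 ; 2∣b = ∣m⇒∣-m 2∣b ; 2∣c = ∣m⇒∣-m 2∣c ; d≡1 = a≡1 }
  where open InΓ₂′ g∈

Γ₂′ : Subgroup
Γ₂′ = record
  { P = InΓ₂′ ; P⇒SL2 = InΓ₂′.unimodular ; P-I = InΓ₂′-I ; P-⊗ = InΓ₂′-⊗ ; P-inv = InΓ₂′-adj }

Γ₈⊆Γ₂′ : ∀ {m} → Γ 8 m → InΓ₂′ m
Γ₈⊆Γ₂′ {mat a b c d} m∈Γ₈ = record
  { unimodular = proj₁ m∈Γ₈
  ; a≡1 = ≡-mod-weaken 4∣8 a≡ ; 2∣b = ≡0-mod⇒∣ (≡-mod-weaken 2∣8 b≡)
  ; 2∣c = ≡0-mod⇒∣ (≡-mod-weaken 2∣8 c≡) ; d≡1 = ≡-mod-weaken 4∣8 d≡ }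
  where open _≋_mod_ (Γ⇒≋I (mat a b c d) m∈Γ₈)

Γ₂′⊆Γ₂ : ∀ {m} → InΓ₂′ m → Γ 2 m
Γ₂′⊆Γ₂ {mat a b c d} m∈ = ≋I⇒Γ unimodular
  (entrywise (≡-mod-weaken 2∣4 a≡1) (∣⇒≡0-mod 2∣b) (∣⇒≡0-mod 2∣c) (≡-mod-weaken 2∣4 d≡1))
  where
  open InΓ₂′ m∈
  2∣4 : 2 ℕ.∣ 4
  2∣4 = ℕ.divides 2 refl

-I∉Γ₂′ : ¬ InΓ₂′ -I
-I∉Γ₂′ -I∈ = toWitnessFalse {a? = -1ℤ ≡? 1ℤ mod 4} _ (InΓ₂′.a≡1 -I∈)

Γ₂⊆±Γ₂′ : ∀ m → Γ 2 m → InΓ₂′ m ⊎ InΓ₂′ (-I ⊗ m)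
Γ₂⊆±Γ₂′ (mat a b c d) m∈Γ₂@(m∈SL2 , _) = by-sign (odd⇒≡±1-mod4 a≡)
  where
  open _≋_mod_ (Γ⇒≋I (mat a b c d) m∈Γ₂)
  2∣b : + 2 ∣ b
  2∣b = ≡0-mod⇒∣ b≡
  2∣c : + 2 ∣ c
  2∣c = ≡0-mod⇒∣ c≡
  ad≡1 : a * d ≡ 1ℤ mod 4
  ad≡1 = ≡-mod-trans (≡-mod-reflexive (split a b c d))
           (+-cong-mod (≡-mod-reflexive m∈SL2) (∣⇒≡0-mod (*-pres-∣ 2∣b 2∣c)))
    where
    split : ∀ a b c d → a * d ≡ (a * d - b * c) + b * c
    split = solve-∀
  by-sign : a ≡ 1ℤ mod 4 ⊎ a ≡ -1ℤ mod 4 → InΓ₂′ (mat a b c d) ⊎ InΓ₂′ (-I ⊗ mat a b c d)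
  by-sign (inj₁ a≡1) = inj₁ record
    { unimodular = m∈SL2 ; a≡1 = a≡1 ; 2∣b = 2∣b ; 2∣c = 2∣c ; d≡1 = inverse-of-self-inverse-mod refl ad≡1 a≡1 }
  by-sign (inj₂ a≡-1) = inj₂ (subst InΓ₂′ (sym (-I⊗-negates a b c d)) record
    { unimodular = subst SL2 (-I⊗-negates a b c d) (SL2-⊗ { -I} {mat a b c d} refl m∈SL2)
    ; a≡1 = -‿cong-mod a≡-1 ; 2∣b = ∣m⇒∣-m 2∣b ; 2∣c = ∣m⇒∣-m 2∣c
    ; d≡1 = -‿cong-mod (inverse-of-self-inverse-mod refl ad≡1 a≡-1) })

toℕ-mod : ∀ {n} .{{_ : NonZero n}} m → toℕ (m ℕ.mod n) ≡ m % n
toℕ-mod {n} m = toℕ-fromℕ< (ℕ.m%n<n m n)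

record NF : Set where
  constructor ⟨_,_,_⟩
  field
    i j : Fin 4
    k : Fin 2

_⋆_ : NF → NF → NF
⟨ i , j , k ⟩ ⋆ ⟨ i′ , j′ , k′ ⟩ =
  ⟨ (toℕ i ℕ.+ toℕ i′) ℕ.mod 4 , (toℕ j ℕ.+ toℕ j′) ℕ.mod 4 , (toℕ i′ ℕ.* toℕ j ℕ.+ (toℕ k ℕ.+ toℕ k′)) ℕ.mod 2 ⟩

module GroupPowers (G : Group 0ℓ 0ℓ) where

  open Group G renaming (refl to ≈-refl; sym to ≈-sym; trans to ≈-trans)
  open GroupProperties G
  open MonoidMult monoid using (×-homo-+; ×-assocˡ; ×-idem; ×-congʳ) renaming (_×_ to _copies-of_)
  open SetoidReasoning setoid

  infixr 8 _^ᴳ_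
  _^ᴳ_ : Carrier → ℕ → Carrier
  x ^ᴳ n = n copies-of x

  Commute : Carrier → Carrier → Set
  Commute g h = g ∙ h ≈ h ∙ g

  commute-^ : ∀ {g h} → Commute g h → ∀ n → Commute g (h ^ᴳ n)
  commute-^ {g} {h} gh zero = ≈-trans (identityʳ g) (≈-sym (identityˡ g))
  commute-^ {g} {h} gh (suc n) = begin
    g ∙ (h ∙ h ^ᴳ n)   ≈⟨ assoc g h _ ⟨
    (g ∙ h) ∙ h ^ᴳ n   ≈⟨ ∙-congʳ gh ⟩
    (h ∙ g) ∙ h ^ᴳ n   ≈⟨ assoc h g _ ⟩
    h ∙ (g ∙ h ^ᴳ n)   ≈⟨ ∙-congˡ (commute-^ gh n) ⟩
    h ∙ (h ^ᴳ n ∙ g)   ≈⟨ assoc h _ g ⟨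
    (h ∙ h ^ᴳ n) ∙ g   ∎

  commute-∙ : ∀ {g h k} → Commute g h → Commute g k → Commute g (h ∙ k)
  commute-∙ {g} {h} {k} gh gk = begin
    g ∙ (h ∙ k)   ≈⟨ assoc g h k ⟨
    (g ∙ h) ∙ k   ≈⟨ ∙-congʳ gh ⟩
    (h ∙ g) ∙ k   ≈⟨ assoc h g k ⟩
    h ∙ (g ∙ k)   ≈⟨ ∙-congˡ gk ⟩
    h ∙ (k ∙ g)   ≈⟨ assoc h k g ⟨
    (h ∙ k) ∙ g   ∎

  ^-+ : ∀ g m n → g ^ᴳ (m ℕ.+ n) ≈ g ^ᴳ m ∙ g ^ᴳ n
  ^-+ g = ×-homo-+ g

  ^-% : ∀ {g} n .{{_ : NonZero n}} → g ^ᴳ n ≈ ε → ∀ m → g ^ᴳ m ≈ g ^ᴳ (m % n)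
  ^-% {g} n gⁿ≈ε m = begin
    g ^ᴳ m                               ≡⟨ cong (g ^ᴳ_) (ℕ.m≡m%n+[m/n]*n m n) ⟩
    g ^ᴳ (m % n ℕ.+ (m / n) ℕ.* n)       ≈⟨ ^-+ g (m % n) _ ⟩
    g ^ᴳ (m % n) ∙ g ^ᴳ ((m / n) ℕ.* n)  ≈⟨ ∙-congˡ (×-assocˡ g (m / n) n) ⟨
    g ^ᴳ (m % n) ∙ (g ^ᴳ n) ^ᴳ (m / n)   ≈⟨ ∙-congˡ (×-congʳ (m / n) gⁿ≈ε) ⟩
    g ^ᴳ (m % n) ∙ ε ^ᴳ (m / n)          ≈⟨ ∙-congˡ (ε^ᴳ (m / n)) ⟩
    g ^ᴳ (m % n) ∙ ε                     ≈⟨ identityʳ _ ⟩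
    g ^ᴳ (m % n)                         ∎
    where
    ε^ᴳ : ∀ q → ε ^ᴳ q ≈ ε
    ε^ᴳ zero = ≈-refl
    ε^ᴳ q@(suc _) = ×-idem (identityˡ ε) q

  commutator : Carrier → Carrier → Carrier
  commutator g h = ((g ⁻¹ ∙ h ⁻¹) ∙ g) ∙ h

  commutator≈ε⇒commute : ∀ g h → commutator g h ≈ ε → Commute g h
  commutator≈ε⇒commute g h [g,h]≈ε = ≈-sym (⁻¹-injective (begin
    (h ∙ g) ⁻¹     ≈⟨ ⁻¹-anti-homo-∙ h g ⟩
    g ⁻¹ ∙ h ⁻¹    ≈⟨ inverseˡ-unique (g ⁻¹ ∙ h ⁻¹) (g ∙ h) (≈-trans (≈-sym (assoc _ g h)) [g,h]≈ε) ⟩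
    (g ∙ h) ⁻¹     ∎))

  commutator-swap : ∀ g h → (h ∙ g) ∙ commutator g h ≈ g ∙ h
  commutator-swap g h = begin
    (h ∙ g) ∙ (((g ⁻¹ ∙ h ⁻¹) ∙ g) ∙ h)   ≈⟨ solve monoid ⟩
    h ∙ ((g ∙ g ⁻¹) ∙ (h ⁻¹ ∙ (g ∙ h)))   ≈⟨ ∙-congˡ (∙-congʳ (inverseʳ g)) ⟩
    h ∙ (ε ∙ (h ⁻¹ ∙ (g ∙ h)))            ≈⟨ solve monoid ⟩
    (h ∙ h ⁻¹) ∙ (g ∙ h)                  ≈⟨ ∙-congʳ (inverseʳ h) ⟩
    ε ∙ (g ∙ h)                           ≈⟨ identityˡ _ ⟩
    g ∙ h                                 ∎

  commute-^^ : ∀ {g h} → Commute g h → ∀ m n → Commute (g ^ᴳ m) (h ^ᴳ n)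
  commute-^^ gh m = commute-^ (≈-sym (commute-^ (≈-sym gh) m))

  module _ {x y d : Carrier} (dx : Commute d x) (dy : Commute d y) (yx : y ∙ x ≈ (x ∙ y) ∙ d) where

    y^∙x : ∀ j → y ^ᴳ j ∙ x ≈ (x ∙ y ^ᴳ j) ∙ d ^ᴳ j
    y^∙x zero = solve monoid
    y^∙x (suc j) = begin
      (y ∙ y ^ᴳ j) ∙ x                    ≈⟨ assoc y _ x ⟩
      y ∙ (y ^ᴳ j ∙ x)                    ≈⟨ ∙-congˡ (y^∙x j) ⟩
      y ∙ ((x ∙ y ^ᴳ j) ∙ d ^ᴳ j)         ≈⟨ solve monoid ⟩
      ((y ∙ x) ∙ y ^ᴳ j) ∙ d ^ᴳ j         ≈⟨ ∙-congʳ (∙-congʳ yx) ⟩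
      (((x ∙ y) ∙ d) ∙ y ^ᴳ j) ∙ d ^ᴳ j   ≈⟨ solve monoid ⟩
      ((x ∙ y) ∙ (d ∙ y ^ᴳ j)) ∙ d ^ᴳ j   ≈⟨ ∙-congʳ (∙-congˡ (commute-^ dy j)) ⟩
      ((x ∙ y) ∙ (y ^ᴳ j ∙ d)) ∙ d ^ᴳ j   ≈⟨ solve monoid ⟩
      (x ∙ (y ∙ y ^ᴳ j)) ∙ (d ∙ d ^ᴳ j)   ∎

    y^∙x^ : ∀ i j → y ^ᴳ j ∙ x ^ᴳ i ≈ (x ^ᴳ i ∙ y ^ᴳ j) ∙ d ^ᴳ (i ℕ.* j)
    y^∙x^ zero j = solve monoid
    y^∙x^ (suc i) j = begin
      y ^ᴳ j ∙ (x ∙ x ^ᴳ i)                                ≈⟨ assoc _ x _ ⟨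
      (y ^ᴳ j ∙ x) ∙ x ^ᴳ i                                ≈⟨ ∙-congʳ (y^∙x j) ⟩
      ((x ∙ y ^ᴳ j) ∙ d ^ᴳ j) ∙ x ^ᴳ i                     ≈⟨ assoc _ _ _ ⟩
      (x ∙ y ^ᴳ j) ∙ (d ^ᴳ j ∙ x ^ᴳ i)                     ≈⟨ ∙-congˡ (commute-^^ dx j i) ⟩
      (x ∙ y ^ᴳ j) ∙ (x ^ᴳ i ∙ d ^ᴳ j)                     ≈⟨ solve monoid ⟩
      (x ∙ (y ^ᴳ j ∙ x ^ᴳ i)) ∙ d ^ᴳ j                     ≈⟨ ∙-congʳ (∙-congˡ (y^∙x^ i j)) ⟩
      (x ∙ ((x ^ᴳ i ∙ y ^ᴳ j) ∙ d ^ᴳ (i ℕ.* j))) ∙ d ^ᴳ j  ≈⟨ solve monoid ⟩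
      ((x ∙ x ^ᴳ i) ∙ y ^ᴳ j) ∙ (d ^ᴳ (i ℕ.* j) ∙ d ^ᴳ j)  ≈⟨ ∙-congˡ (^-+ d (i ℕ.* j) j) ⟨
      ((x ∙ x ^ᴳ i) ∙ y ^ᴳ j) ∙ d ^ᴳ (i ℕ.* j ℕ.+ j)       ≡⟨ cong (λ e → ((x ∙ x ^ᴳ i) ∙ y ^ᴳ j) ∙ d ^ᴳ e) (ℕ.+-comm (i ℕ.* j) j) ⟩
      ((x ∙ x ^ᴳ i) ∙ y ^ᴳ j) ∙ d ^ᴳ (j ℕ.+ i ℕ.* j)       ∎

  module NormalForm (x y : Carrier)
    (x⁴≈ε : x ^ᴳ 4 ≈ ε) (y⁴≈ε : y ^ᴳ 4 ≈ ε) ([x,y]²≈ε : commutator x y ^ᴳ 2 ≈ ε)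
    (commute-x : Commute (commutator x y) x) (commute-y : Commute (commutator x y) y) where

    [x,y] : Carrier
    [x,y] = commutator x y

    yx≈xy[x,y] : y ∙ x ≈ (x ∙ y) ∙ [x,y]
    yx≈xy[x,y] = begin
      y ∙ x                             ≈⟨ identityʳ _ ⟨
      (y ∙ x) ∙ ε                       ≈⟨ ∙-congˡ [x,y]²≈ε ⟨
      (y ∙ x) ∙ ([x,y] ∙ ([x,y] ∙ ε))   ≈⟨ solve monoid ⟩
      ((y ∙ x) ∙ [x,y]) ∙ [x,y]         ≈⟨ ∙-congʳ (commutator-swap x y) ⟩
      (x ∙ y) ∙ [x,y]                   ∎

    Ψ : ℕ → ℕ → ℕ → Carrier
    Ψ i j k = (x ^ᴳ i ∙ y ^ᴳ j) ∙ [x,y] ^ᴳ k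

    Ψ-∙ : ∀ i j k i′ j′ k′ → Ψ i j k ∙ Ψ i′ j′ k′ ≈ Ψ (i ℕ.+ i′) (j ℕ.+ j′) (i′ ℕ.* j ℕ.+ (k ℕ.+ k′))
    Ψ-∙ i j k i′ j′ k′ = begin
      ((X i ∙ Y j) ∙ C k) ∙ ((X i′ ∙ Y j′) ∙ C k′)
        ≈⟨ solve monoid ⟩
      (X i ∙ Y j) ∙ ((C k ∙ (X i′ ∙ Y j′)) ∙ C k′)
        ≈⟨ ∙-congˡ (∙-congʳ (commute-∙ (commute-^^ commute-x k i′) (commute-^^ commute-y k j′))) ⟩
      (X i ∙ Y j) ∙ (((X i′ ∙ Y j′) ∙ C k) ∙ C k′)
        ≈⟨ solve monoid ⟩
      (X i ∙ (Y j ∙ X i′)) ∙ (Y j′ ∙ (C k ∙ C k′))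
        ≈⟨ ∙-congʳ (∙-congˡ (y^∙x^ commute-x commute-y yx≈xy[x,y] i′ j)) ⟩
      (X i ∙ ((X i′ ∙ Y j) ∙ C (i′ ℕ.* j))) ∙ (Y j′ ∙ (C k ∙ C k′))
        ≈⟨ solve monoid ⟩
      (X i ∙ X i′) ∙ (Y j ∙ ((C (i′ ℕ.* j) ∙ Y j′) ∙ (C k ∙ C k′)))
        ≈⟨ ∙-congˡ (∙-congˡ (∙-congʳ (commute-^^ commute-y (i′ ℕ.* j) j′))) ⟩
      (X i ∙ X i′) ∙ (Y j ∙ ((Y j′ ∙ C (i′ ℕ.* j)) ∙ (C k ∙ C k′)))
        ≈⟨ solve monoid ⟩
      ((X i ∙ X i′) ∙ (Y j ∙ Y j′)) ∙ (C (i′ ℕ.* j) ∙ (C k ∙ C k′))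
        ≈⟨ ∙-cong (∙-cong (^-+ x i i′) (^-+ y j j′)) (≈-trans (^-+ [x,y] (i′ ℕ.* j) (k ℕ.+ k′)) (∙-congˡ (^-+ [x,y] k k′))) ⟨
      Ψ (i ℕ.+ i′) (j ℕ.+ j′) (i′ ℕ.* j ℕ.+ (k ℕ.+ k′))
        ∎
      where
      X Y C : ℕ → Carrier
      X = x ^ᴳ_
      Y = y ^ᴳ_
      C = [x,y] ^ᴳ_

    Ψ-reduce : ∀ i j k → Ψ i j k ≈ Ψ (i % 4) (j % 4) (k % 2)
    Ψ-reduce i j k = ∙-cong (∙-cong (^-% 4 x⁴≈ε i) (^-% 4 y⁴≈ε j)) (^-% 2 [x,y]²≈ε k)

    Φ : NF → Carrier
    Φ ⟨ i , j , k ⟩ = Ψ (toℕ i) (toℕ j) (toℕ k)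

    Φ-⋆ : ∀ n n′ → Φ n ∙ Φ n′ ≈ Φ (n ⋆ n′)
    Φ-⋆ ⟨ i , j , k ⟩ ⟨ i′ , j′ , k′ ⟩
      rewrite toℕ-mod {4} (toℕ i ℕ.+ toℕ i′) | toℕ-mod {4} (toℕ j ℕ.+ toℕ j′)
            | toℕ-mod {2} (toℕ i′ ℕ.* toℕ j ℕ.+ (toℕ k ℕ.+ toℕ k′))
      = ≈-trans (Ψ-∙ (toℕ i) (toℕ j) (toℕ k) (toℕ i′) (toℕ j′) (toℕ k′))
                (Ψ-reduce (toℕ i ℕ.+ toℕ i′) (toℕ j ℕ.+ toℕ j′) (toℕ i′ ℕ.* toℕ j ℕ.+ (toℕ k ℕ.+ toℕ k′)))

A B : M2
A = mat 1ℤ (+ 2) 0ℤ 1ℤ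
B = mat 1ℤ 0ℤ (+ 2) 1ℤ

A∈Γ₂′ : InΓ₂′ A
A∈Γ₂′ = record
  { unimodular = refl ; a≡1 = ≡-mod-refl ; 2∣b = divides 1ℤ refl ; 2∣c = divides 0ℤ refl ; d≡1 = ≡-mod-refl }

B∈Γ₂′ : InΓ₂′ B
B∈Γ₂′ = record
  { unimodular = refl ; a≡1 = ≡-mod-refl ; 2∣b = divides 0ℤ refl ; 2∣c = divides 1ℤ refl ; d≡1 = ≡-mod-refl }

evalM-∈ : ∀ (H : Subgroup) {g h} → Subgroup.P H g → Subgroup.P H h → ∀ w → Subgroup.P H (evalM w g h)
evalM-∈ H g∈ h∈ σ = g∈
evalM-∈ H g∈ h∈ τ = h∈
evalM-∈ H g∈ h∈ e = Subgroup.P-I H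
evalM-∈ H g∈ h∈ (w · v) = Subgroup.P-⊗ H (evalM-∈ H g∈ h∈ w) (evalM-∈ H g∈ h∈ v)
evalM-∈ H g∈ h∈ (w ⁻) = Subgroup.P-inv H (evalM-∈ H g∈ h∈ w)

normal-word : NF → Word
normal-word ⟨ i , j , k ⟩ = σ ^ toℕ i · τ ^ toℕ j · [ σ , τ ] ^ toℕ k

normal-residue : NF → M2
normal-residue n = residue 8 (evalM (normal-word n) A B)

record InΓ₂′mod8 (r : M2) : Set where
  field
    det≡1 : det r ≡ 1ℤ mod 8
    a≡1 : a r ≡ 1ℤ mod 4
    b≡0 : b r ≡ 0ℤ mod 2
    c≡0 : c r ≡ 0ℤ mod 2
    d≡1 : d r ≡ 1ℤ mod 4

_≟M_ : ∀ (g h : M2) → Dec (g ≡ h)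
mat a b c d ≟M mat a′ b′ c′ d′ =
  map′ (λ (p , q , r , s) → mat-cong p q r s)
       (λ eq → cong M2.a eq , cong M2.b eq , cong M2.c eq , cong M2.d eq)
       ((a ℤ.≟ a′) ×-dec (b ℤ.≟ b′) ×-dec (c ℤ.≟ c′) ×-dec (d ℤ.≟ d′))

_≟NF_ : ∀ (n n′ : NF) → Dec (n ≡ n′)
⟨ i , j , k ⟩ ≟NF ⟨ i′ , j′ , k′ ⟩ =
  map′ (λ { (refl , refl , refl) → refl }) (λ { refl → refl , refl , refl })
       ((i Fin.≟ i′) ×-dec (j Fin.≟ j′) ×-dec (k Fin.≟ k′))

all-NF? : ∀ {P : NF → Set} → (∀ n → Dec (P n)) → Dec (∀ n → P n)
all-NF? P? = map′ (λ all n → all (NF.i n) (NF.j n) (NF.k n)) (λ all i j k → all ⟨ i , j , k ⟩)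
  (all? λ i → all? λ j → all? λ k → P? ⟨ i , j , k ⟩)

any-NF? : ∀ {P : NF → Set} → (∀ n → Dec (P n)) → Dec (∃ P)
any-NF? P? = map′ (λ (i , j , k , p) → ⟨ i , j , k ⟩ , p) (λ (⟨ i , j , k ⟩ , p) → i , j , k , p)
  (any? λ i → any? λ j → any? λ k → P? ⟨ i , j , k ⟩)

InΓ₂′mod8? : ∀ r → Dec (InΓ₂′mod8 r)
InΓ₂′mod8? r =
  map′ (λ (p , q , u , v , w) → record { det≡1 = p ; a≡1 = q ; b≡0 = u ; c≡0 = v ; d≡1 = w })
       (λ r∈ → let open InΓ₂′mod8 r∈ in det≡1 , a≡1 , b≡0 , c≡0 , d≡1)
       ((det r ≡? 1ℤ mod 8) ×-dec (a r ≡? 1ℤ mod 4) ×-dec (b r ≡? 0ℤ mod 2) ×-dec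
        (c r ≡? 0ℤ mod 2) ×-dec (d r ≡? 1ℤ mod 4))

Γ? : ∀ N m → Dec (Γ N m)
Γ? N (mat a b c d) =
  (a * d - b * c ℤ.≟ 1ℤ) ×-dec (N ℕ.∣? ∣ a - 1ℤ ∣) ×-dec (N ℕ.∣? ∣ b ∣) ×-dec
  (N ℕ.∣? ∣ c ∣) ×-dec (N ℕ.∣? ∣ d - 1ℤ ∣)

relators-hold-mod-8 : All (λ r → Γ 8 (adj (evalM r A B) ⊗ I)) relators
relators-hold-mod-8 = toWitness {a? = All.all? (λ r → Γ? 8 (adj (evalM r A B) ⊗ I)) relators} _

opaque
  normal-residue-⋆ : ∀ n n′ → residue 8 (normal-residue n ⊗ normal-residue n′) ≡ normal-residue (n ⋆ n′)
  normal-residue-⋆ = toWitness {a? = all-NF? λ n → all-NF? λ n′ →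
    residue 8 (normal-residue n ⊗ normal-residue n′) ≟M normal-residue (n ⋆ n′)} _

  normal-residue-injective : ∀ n n′ → normal-residue n ≡ normal-residue n′ → n ≡ n′
  normal-residue-injective = toWitness {a? = all-NF? λ n → all-NF? λ n′ →
    (normal-residue n ≟M normal-residue n′) →-dec (n ≟NF n′)} _

  InΓ₂′mod8-normal : ∀ (a b c d : Fin 8) → InΓ₂′mod8 (matFin a b c d) → ∃ λ n → matFin a b c d ≡ normal-residue n
  InΓ₂′mod8-normal = toWitness {a? = all? λ a → all? λ b → all? λ c → all? λ d →
    InΓ₂′mod8? (matFin a b c d) →-dec any-NF? λ n → matFin a b c d ≟M normal-residue n} _

Γ-quotient⇒≋ : ∀ {n g h} → SL2 g → Γ n (adj g ⊗ h) → g ≋ h mod n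
Γ-quotient⇒≋ {n} {g} {h} g∈SL2 g⁻¹h∈Γ = ≋-sym (begin
  h                 ≡⟨ ⊗-identityˡ h ⟨
  I ⊗ h             ≡⟨ cong (_⊗ h) (adj-inverseʳ {g} g∈SL2) ⟨
  (g ⊗ adj g) ⊗ h   ≡⟨ ⊗-assoc g (adj g) h ⟩
  g ⊗ (adj g ⊗ h)   ≈⟨ ⊗-cong-mod (≋-refl {g = g}) (Γ⇒≋I (adj g ⊗ h) g⁻¹h∈Γ) ⟩
  g ⊗ I             ≡⟨ ⊗-identityʳ g ⟩
  g                 ∎)
  where open ≋-Reasoning n

≋⇒Γ-quotient : ∀ {n g h} → SL2 g → SL2 h → g ≋ h mod n → Γ n (adj g ⊗ h)
≋⇒Γ-quotient {n} {g} {h} g∈SL2 h∈SL2 g≋h =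
  ≋I⇒Γ (SL2-⊗ {adj g} {h} (SL2-adj {g} g∈SL2) h∈SL2) (begin
  adj g ⊗ h   ≈⟨ ⊗-cong-mod (≋-refl {g = adj g}) (≋-sym g≋h) ⟩
  adj g ⊗ g   ≡⟨ adj-inverseˡ {g} g∈SL2 ⟩
  I           ∎)
  where open ≋-Reasoning n

InΓ₂′⇒InΓ₂′mod8 : ∀ {m} → InΓ₂′ m → InΓ₂′mod8 (residue 8 m)
InΓ₂′⇒InΓ₂′mod8 {m} m∈ = record
  { det≡1 = ≡-mod-trans (≡-mod-sym (det-cong-mod (≋-residue m))) (≡-mod-reflexive unimodular)
  ; a≡1 = ≡-mod-trans (≡-mod-sym (≡-mod-weaken 4∣8 a≡)) a≡1
  ; b≡0 = ≡-mod-trans (≡-mod-sym (≡-mod-weaken 2∣8 b≡)) (∣⇒≡0-mod 2∣b)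
  ; c≡0 = ≡-mod-trans (≡-mod-sym (≡-mod-weaken 2∣8 c≡)) (∣⇒≡0-mod 2∣c)
  ; d≡1 = ≡-mod-trans (≡-mod-sym (≡-mod-weaken 4∣8 d≡)) d≡1
  }
  where
  open InΓ₂′ m∈
  open _≋_mod_ (≋-residue {8} m)

normal-form : ∀ m → InΓ₂′ m → Σ NF λ n → residue 8 m ≡ normal-residue n
normal-form (mat a b c d) m∈ =
  InΓ₂′mod8-normal (a modℤ 8) (b modℤ 8) (c modℤ 8) (d modℤ 8) (InΓ₂′⇒InΓ₂′mod8 m∈)

-- Opaque, so that conversion checking never unfolds the enumeration behind nf.
opaque
  nf : ∀ m → InΓ₂′ m → NF
  nf m m∈ = proj₁ (normal-form m m∈)

  residue≡normal-residue-nf : ∀ m (m∈ : InΓ₂′ m) → residue 8 m ≡ normal-residue (nf m m∈)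
  residue≡normal-residue-nf m m∈ = proj₂ (normal-form m m∈)

nf-unique : ∀ {m} (m∈ : InΓ₂′ m) {n} → residue 8 m ≡ normal-residue n → nf m m∈ ≡ n
nf-unique {m} m∈ {n} eq =
  normal-residue-injective (nf m m∈) n (trans (sym (residue≡normal-residue-nf m m∈)) eq)

Γ₂′-generated : ∀ m → InΓ₂′ m → Σ Word λ w → Γ 8 (adj (evalM w A B) ⊗ m)
Γ₂′-generated m m∈ = normal-word n , ≋⇒Γ-quotient {g = evalM (normal-word n) A B} {h = m}
  (InΓ₂′.unimodular (evalM-∈ Γ₂′ A∈Γ₂′ B∈Γ₂′ (normal-word n))) (InΓ₂′.unimodular m∈)
  (residue-injective (sym (residue≡normal-residue-nf m m∈)))
  where n = nf m m∈

module _ (G : Group 0ℓ 0ℓ) where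

  open Group G renaming (refl to ≈-refl; sym to ≈-sym; trans to ≈-trans)
  open GroupPowers G

  induced-homomorphism : (x y : Carrier) → All (λ r → evalG G x y r ≈ ε) relators →
    Σ ((m : M2) → InΓ₂′ m → Carrier) λ f →
      (∀ g h (g∈ : InΓ₂′ g) (h∈ : InΓ₂′ h) → Γ 8 (adj g ⊗ h) → f g g∈ ≈ f h h∈) ×
      (∀ g h (g∈ : InΓ₂′ g) (h∈ : InΓ₂′ h) → f (g ⊗ h) (InΓ₂′-⊗ g∈ h∈) ≈ f g g∈ ∙ f h h∈) ×
      f A A∈Γ₂′ ≈ x × f B B∈Γ₂′ ≈ y
  induced-homomorphism x y (x⁴≈ε ∷ y⁴≈ε ∷ _ ∷ _ ∷ [x,y]²≈ε ∷ [[x,y],x]≈ε ∷ [[x,y],y]≈ε ∷ []) =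
    f , respects , multiplicative , f-A , f-B
    where
    open NormalForm x y x⁴≈ε y⁴≈ε [x,y]²≈ε
      (commutator≈ε⇒commute (commutator x y) x [[x,y],x]≈ε)
      (commutator≈ε⇒commute (commutator x y) y [[x,y],y]≈ε)

    f : (m : M2) → InΓ₂′ m → Carrier
    f m m∈ = Φ (nf m m∈)

    f-A : f A A∈Γ₂′ ≈ x
    f-A = begin
      Φ (nf A A∈Γ₂′)          ≡⟨ cong Φ (nf-unique A∈Γ₂′ {⟨ 1F , 0F , 0F ⟩} refl) ⟩
      ((x ∙ ε) ∙ ε) ∙ ε       ≈⟨ solve monoid ⟩
      x                       ∎
      where open SetoidReasoning setoid

    f-B : f B B∈Γ₂′ ≈ y
    f-B = begin
      Φ (nf B B∈Γ₂′)          ≡⟨ cong Φ (nf-unique B∈Γ₂′ {⟨ 0F , 1F , 0F ⟩} refl) ⟩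
      (ε ∙ (y ∙ ε)) ∙ ε       ≈⟨ solve monoid ⟩
      y                       ∎
      where open SetoidReasoning setoid

    respects : ∀ g h (g∈ : InΓ₂′ g) (h∈ : InΓ₂′ h) → Γ 8 (adj g ⊗ h) → f g g∈ ≈ f h h∈
    respects g h g∈ h∈ g⁻¹h∈Γ₈ = reflexive (cong Φ (nf-unique g∈ {nf h h∈} (begin
      residue 8 g                ≡⟨ residue-cong (Γ-quotient⇒≋ {g = g} {h} (InΓ₂′.unimodular g∈) g⁻¹h∈Γ₈) ⟩
      residue 8 h                ≡⟨ residue≡normal-residue-nf h h∈ ⟩
      normal-residue (nf h h∈)   ∎)))
      where open ≡-Reasoning

    multiplicative : ∀ g h (g∈ : InΓ₂′ g) (h∈ : InΓ₂′ h) → f (g ⊗ h) (InΓ₂′-⊗ g∈ h∈) ≈ f g g∈ ∙ f h h∈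
    multiplicative g h g∈ h∈ =
      ≈-trans (reflexive (cong Φ (nf-unique (InΓ₂′-⊗ g∈ h∈) {nf g g∈ ⋆ nf h h∈} residue-of-product)))
              (≈-sym (Φ-⋆ (nf g g∈) (nf h h∈)))
      where
      open ≡-Reasoning
      residue-of-product : residue 8 (g ⊗ h) ≡ normal-residue (nf g g∈ ⋆ nf h h∈)
      residue-of-product = begin
        residue 8 (g ⊗ h)
          ≡⟨ residue-⊗ g h ⟩
        residue 8 (residue 8 g ⊗ residue 8 h)
          ≡⟨ cong₂ (λ r r′ → residue 8 (r ⊗ r′)) (residue≡normal-residue-nf g g∈) (residue≡normal-residue-nf h h∈) ⟩
        residue 8 (normal-residue (nf g g∈) ⊗ normal-residue (nf h h∈))
          ≡⟨ normal-residue-⋆ (nf g g∈) (nf h h∈) ⟩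
        normal-residue (nf g g∈ ⋆ nf h h∈)
          ∎

lemma7 : Σ Subgroup λ H →
           IsComplementOfSign H ×
           (∀ {m} → Γ 8 m → Subgroup.P H m) ×
           HasPresentationModΓ8 H
lemma7 =
  Γ₂′ , (Γ₂′⊆Γ₂ , -I∉Γ₂′ , Γ₂⊆±Γ₂′) , Γ₈⊆Γ₂′ ,
  A , B , A∈Γ₂′ , B∈Γ₂′ , relators-hold-mod-8 , Γ₂′-generated , induced-homomorphism
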